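{- Let $X$ be a finite set with $|X|\ge3$ and $c$ an imbalanced partial choice function on pairs from $X$. Then $V^*(c)$ contains a point $(p,q)$ with $p+q>0$ and a point $(p',q')$ with $p'+q'<0$.
   Context: A partial choice function is a map $c$ from a set of 2-element subsets of $X$ with $c\{x,y\}\in\{x,y\}$. $W^x_y(c)$ is $1$ if $c\{x,y\}=x$, $-1$ if $c\{x,y\}=y$, $0$ if $\{x,y\}\notin\operatorname{dom}c$ (including $x=y$). $\operatorname{val}_c(x)=\sum_{y\in X}W^x_y(c)$; $c$ is imbalanced if some valence is nonzero. For $\ell\in\{ -1,0,1\}$, $V_\ell(c)=\{(\operatorname{val}_c(x)-\ell,\operatorname{val}_c(y)+\ell): x\neq y,\ W^x_y(c)=\ell\}$. For $A\subseteq\mathbb{Q}\times\mathbb{Q}$, $\operatorname{conv}(A)$ is its convex hull in $\mathbb{Q}\times\mathbb{Q}$. $V^*(c)$ is the set of points $a\bar v_1+(1-a)\bar v_0$ with $a\in(0,1]\cap\mathbb{Q}$, $\bar v_1\in\operatorname{conv}(V_1(c))$, $\bar v_0\in\operatorname{conv}(V_0(c))$, where for $a=1$ the point $\bar v_0$ is not needed, so that $\operatorname{conv}(V_1(c))\subseteq V^*(c)$ even if $V_0(c)=\emptyset$. -}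

module Defs where

open import Data.Nat using (ℕ)
open import Data.Fin using (Fin)
open import Data.Fin.Properties using (_≟_)
open import Data.Maybe using (Maybe; just; nothing)
open import Data.Integer as ℤ using (ℤ; +_; -[1+_])
open import Data.Rational as ℚ using (ℚ; 0ℚ; 1ℚ; _/_)
open import Data.List using (List; []; _∷_; map; foldr; allFin)
open import Data.List.Relation.Unary.All using (All)
open import Data.Product using (_×_; _,_; Σ; ∃; ∃-syntax; proj₁; proj₂)
open import Data.Sum using (_⊎_)
open import Relation.Nullary using (¬_; yes; no)
open import Relation.Binary.PropositionalEquality using (_≡_; _≢_)

-- An unordered pair {x,y} (x ≢ y) is represented symmetrically:
-- ch x y ≡ ch y x; ch x y ≡ nothing means {x,y} ∉ dom c;
-- ch x y ≡ just z means c{x,y} = z, and z ∈ {x,y}.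
record PartialChoice (n : ℕ) : Set where
  field
    ch      : Fin n → Fin n → Maybe (Fin n)
    symm    : ∀ x y → ch x y ≡ ch y x
    diag    : ∀ x → ch x x ≡ nothing
    chooses : ∀ x y z → ch x y ≡ just z → z ≡ x ⊎ z ≡ y
open PartialChoice public

W : ∀ {n} → PartialChoice n → Fin n → Fin n → ℤ
W c x y with ch c x y
... | nothing = + 0
... | just z with z ≟ x
...   | yes _ = + 1
...   | no _  = -[1+ 0 ]

sumℤ : List ℤ → ℤ
sumℤ = foldr ℤ._+_ (+ 0)

val : ∀ {n} → PartialChoice n → Fin n → ℤ
val {n} c x = sumℤ (map (W c x) (allFin n))

Imbalanced : ∀ {n} → PartialChoice n → Set
Imbalanced {n} c = ∃[ x ] val c x ≢ + 0

toℚ : ℤ → ℚ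
toℚ z = z / 1

Point : Set
Point = ℚ × ℚ

-- V_ℓ(c) as a predicate on ℚ × ℚ (ℓ ∈ {-1,0,1} given as an integer)
V : ∀ {n} → PartialChoice n → ℤ → Point → Set
V {n} c ℓ pt = ∃[ x ] ∃[ y ] (x ≢ y × W c x y ≡ ℓ ×
  pt ≡ (toℚ (val c x ℤ.- ℓ) , toℚ (val c y ℤ.+ ℓ)))

_·_ : ℚ → Point → Point
a · (p , q) = (a ℚ.* p , a ℚ.* q)

_⊕_ : Point → Point → Point
(p , q) ⊕ (p' , q') = (p ℚ.+ p' , q ℚ.+ q')

combo : List (ℚ × Point) → Point
combo = foldr (λ wp acc → (proj₁ wp · proj₂ wp) ⊕ acc) (0ℚ , 0ℚ)

weightSum : List (ℚ × Point) → ℚ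
weightSum = foldr (λ wp acc → proj₁ wp ℚ.+ acc) 0ℚ

Conv : (Point → Set) → Point → Set
Conv A pt = ∃[ ws ] (All (λ wp → 0ℚ ℚ.≤ proj₁ wp × A (proj₂ wp)) ws
  × weightSum ws ≡ 1ℚ × combo ws ≡ pt)

Vstar : ∀ {n} → PartialChoice n → Point → Set
Vstar c pt = ∃[ a ] (0ℚ ℚ.< a × a ℚ.≤ 1ℚ × ∃[ v₁ ] (Conv (V c (+ 1)) v₁ ×
  ((a ≡ 1ℚ × pt ≡ v₁)
   ⊎ ∃[ v₀ ] (Conv (V c (+ 0)) v₀ × pt ≡ (a · v₁) ⊕ ((1ℚ ℚ.- a) · v₀)))))

-- Every point of V_ℓ(c) coming from a pair (x,y) has coordinate sum
-- val x + val y, and coordinate sums are linear, so it suffices to control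
-- sums of two valences. The proof has three ingredients.
--   * Valences sum to zero (W is antisymmetric), so by a counting argument
--     over a set of size n ≥ 3, a valence vector that is not identically zero
--     has a pair x ≢ y with val x + val y > 0, and one with a negative sum.
--   * A vertex of nonzero valence lies on a decided pair, so V₁(c) ≠ ∅.
--   * If the pair {x,y} is decided, its own point of V₁(c) ⊆ V*(c) has
--     the required coordinate sum. Otherwise its point lies in V₀(c); mixing it
--     with a point of V₁(c) with the small weight a = 1/(|S₁|+2) gives a point
--     of V*(c) whose sum a·S₁ + (1-a)·S₀ keeps the sign of S₀ = val x + val y.
module Submission where

open import Defs
open import Data.Nat as ℕ using (ℕ; suc; zero; _≤_)
import Data.Nat.Properties as ℕP
open import Data.Nat.Coprimality using (1-coprimeTo) renaming (sym to coprime-sym)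
open import Data.Fin using (Fin; zero; suc; punchIn)
open import Data.Fin.Properties using (punchInᵢ≢i; any?) renaming (_≟_ to _≟ᶠ_)
open import Data.Integer as ℤ using (ℤ; +_; -[1+_]; +[1+_])
import Data.Integer.Properties as ℤP
open import Data.Integer.Tactic.RingSolver using (solve-∀)
open import Data.Rational as ℚ using (ℚ; mkℚ; 0ℚ; 1ℚ; _<_; _+_; _*_; _-_)
import Data.Rational.Properties as ℚP
open import Data.Rational.Unnormalised using (*≡*)
import Data.Rational.Unnormalised.Properties as ℚᵘP
open import Data.Rational.Solver using (module +-*-Solver)
open import Data.List using ([]; _∷_; tabulate)
open import Data.List.Properties using (map-tabulate)
open import Data.List.Relation.Unary.All using ([]; _∷_)
open import Data.Maybe using (Maybe; just; nothing)
open import Data.Vec.Functional using (replicate; removeAt)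
open import Algebra.Properties.CommutativeMonoid.Sum ℤP.+-0-commutativeMonoid
  using (sum; sum-remove; sum-cong-≗; sum-replicate-zero; ∑-distrib-+; ∑-comm)
open import Data.Product using (_×_; _,_; ∃-syntax)
open import Data.Sum using (_⊎_; inj₁; inj₂)
open import Data.Empty using (⊥-elim)
open import Relation.Nullary using (yes; no)
open import Relation.Nullary.Decidable using (_×-dec_; ¬?; decidable-stable)
open import Relation.Binary.PropositionalEquality

-- The integer z as a rational in normal form (denominator 1); toℚ z equals it,
-- which makes toℚ a ring homomorphism preserving strict signs.
fromℤ : ℤ → ℚ
fromℤ z = mkℚ z 0 (coprime-sym (1-coprimeTo ℤ.∣ z ∣))

toℚ≡fromℤ : ∀ z → toℚ z ≡ fromℤ z
toℚ≡fromℤ z = ℚP.↥p/↧p≡p (fromℤ z)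

toℚ-+ : ∀ a b → toℚ (a ℤ.+ b) ≡ toℚ a + toℚ b
toℚ-+ a b rewrite toℚ≡fromℤ (a ℤ.+ b) | toℚ≡fromℤ a | toℚ≡fromℤ b =
  ℚP.toℚᵘ-injective (ℚᵘP.≃-sym (ℚᵘP.≃-trans (ℚP.toℚᵘ-homo-+ (fromℤ a) (fromℤ b))
    (*≡* (ring a b))))
  where
  ring : ∀ a b → (a ℤ.* + 1 ℤ.+ b ℤ.* + 1) ℤ.* + 1 ≡ (a ℤ.+ b) ℤ.* (+ 1 ℤ.* + 1)
  ring = solve-∀

toℚ-* : ∀ a b → toℚ (a ℤ.* b) ≡ toℚ a * toℚ b
toℚ-* a b rewrite toℚ≡fromℤ (a ℤ.* b) | toℚ≡fromℤ a | toℚ≡fromℤ b =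
  ℚP.toℚᵘ-injective (ℚᵘP.≃-sym (ℚᵘP.≃-trans (ℚP.toℚᵘ-homo-* (fromℤ a) (fromℤ b))
    (*≡* (ring a b))))
  where
  ring : ∀ a b → (a ℤ.* b) ℤ.* + 1 ≡ (a ℤ.* b) ℤ.* (+ 1 ℤ.* + 1)
  ring = solve-∀

toℚ-pos : ∀ {z} → ℤ.+0 ℤ.< z → 0ℚ < toℚ z
toℚ-pos {z} 0<z rewrite toℚ≡fromℤ z = ℚ.*<* (subst (ℤ.+0 ℤ.<_) (sym (ℤP.*-identityʳ z)) 0<z)

toℚ-neg : ∀ {z} → z ℤ.< ℤ.+0 → toℚ z < 0ℚ
toℚ-neg {z} z<0 rewrite toℚ≡fromℤ z = ℚ.*<* (subst (ℤ._< ℤ.+0) (sym (ℤP.*-identityʳ z)) z<0)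

offset-positive : ∀ i → ℤ.+0 ℤ.< i ℤ.+ + suc ℤ.∣ i ∣
offset-positive (+ n)    = ℤ.+<+ (ℕP.≤-trans (ℕ.s≤s ℕ.z≤n) (ℕP.m≤n+m (suc n) n))
offset-positive -[1+ n ] = subst (ℤ.+0 ℤ.<_) (sym sum≡1) (ℤ.+<+ (ℕ.s≤s ℕ.z≤n))
  where
  sum≡1 : -[1+ n ] ℤ.+ + suc (suc n) ≡ + 1
  sum≡1 = trans (ℤP.⊖-≥ (ℕP.n≤1+n (suc n))) (cong +_ (ℕP.m+n∸n≡m 1 n))

numerator-pos : ∀ S₁ {S₀} → ℤ.+0 ℤ.< S₀ → ℤ.+0 ℤ.< S₁ ℤ.+ + suc ℤ.∣ S₁ ∣ ℤ.* S₀
numerator-pos S₁ {S₀} 0<S₀ = ℤP.<-≤-trans (offset-positive S₁) (ℤP.+-monoʳ-≤ S₁ K≤KS₀)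
  where
  K = + suc ℤ.∣ S₁ ∣
  K≤KS₀ : K ℤ.≤ K ℤ.* S₀
  K≤KS₀ = subst (ℤ._≤ K ℤ.* S₀) (ℤP.*-identityʳ K) (ℤP.*-monoˡ-≤-nonNeg K (ℤP.i<j⇒suc[i]≤j 0<S₀))

numerator-neg : ∀ S₁ {S₀} → S₀ ℤ.< ℤ.+0 → S₁ ℤ.+ + suc ℤ.∣ S₁ ∣ ℤ.* S₀ ℤ.< ℤ.+0
numerator-neg S₁ {S₀} S₀<0 = ℤP.neg-cancel-< (subst (ℤ.+0 ℤ.<_) negated
  (numerator-pos (ℤ.- S₁) (ℤP.neg-mono-< S₀<0)))
  where
  ring : ∀ s₁ k s₀ → ℤ.- s₁ ℤ.+ k ℤ.* ℤ.- s₀ ≡ ℤ.- (s₁ ℤ.+ k ℤ.* s₀)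
  ring = solve-∀
  negated : ℤ.- S₁ ℤ.+ + suc ℤ.∣ ℤ.- S₁ ∣ ℤ.* ℤ.- S₀ ≡ ℤ.- (S₁ ℤ.+ + suc ℤ.∣ S₁ ∣ ℤ.* S₀)
  negated rewrite ℤP.∣-i∣≡∣i∣ S₁ = ring S₁ (+ suc ℤ.∣ S₁ ∣) S₀

scaled-mixture : ∀ m .{{_ : ℚ.NonZero m}} s₁ s₀ →
  m * (ℚ.1/ m * s₁ + (1ℚ - ℚ.1/ m) * s₀) ≡ s₁ + (m - 1ℚ) * s₀
scaled-mixture m s₁ s₀ = begin
  m * (a * s₁ + (1ℚ - a) * s₀)        ≡⟨ distribute m a s₁ s₀ ⟩
  (m * a) * s₁ + (m - m * a) * s₀     ≡⟨ cong (λ t → t * s₁ + (m - t) * s₀) (ℚP.*-inverseʳ m) ⟩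
  1ℚ * s₁ + (m - 1ℚ) * s₀             ≡⟨ cong (_+ (m - 1ℚ) * s₀) (ℚP.*-identityˡ s₁) ⟩
  s₁ + (m - 1ℚ) * s₀                  ∎
  where
  open ≡-Reasoning
  open +-*-Solver
  a = ℚ.1/ m
  distribute : ∀ m a s₁ s₀ → m * (a * s₁ + (1ℚ - a) * s₀) ≡ (m * a) * s₁ + (m - m * a) * s₀
  distribute = solve 4 (λ m a s₁ s₀ → m :* (a :* s₁ :+ (con 1ℚ :- a) :* s₀)
                                   := (m :* a) :* s₁ :+ (m :- m :* a) :* s₀) refl

MixesInto : (ℚ → Set) → ℤ → ℤ → Set
MixesInto P S₁ S₀ = ∃[ a ] (0ℚ < a × a ℚ.≤ 1ℚ × P (a * toℚ S₁ + (1ℚ - a) * toℚ S₀))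

-- |S₁| + 2 as a rational; its inverse is the weight with which S₁ is mixed into S₀.
scale : ℤ → ℚ
scale S₁ = fromℤ (+ suc (suc ℤ.∣ S₁ ∣))

small-weight-mixture : ∀ S₁ S₀ →
  scale S₁ * (ℚ.1/ scale S₁ * toℚ S₁ + (1ℚ - ℚ.1/ scale S₁) * toℚ S₀)
    ≡ toℚ (S₁ ℤ.+ + suc ℤ.∣ S₁ ∣ ℤ.* S₀)
small-weight-mixture S₁ S₀ = begin
  M * (ℚ.1/ M * toℚ S₁ + (1ℚ - ℚ.1/ M) * toℚ S₀) ≡⟨ scaled-mixture M (toℚ S₁) (toℚ S₀) ⟩
  toℚ S₁ + (M - 1ℚ) * toℚ S₀                      ≡⟨ cong (λ t → toℚ S₁ + t * toℚ S₀) M-1≡K ⟩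
  toℚ S₁ + toℚ K * toℚ S₀                         ≡⟨ cong (λ t → toℚ S₁ + t) (sym (toℚ-* K S₀)) ⟩
  toℚ S₁ + toℚ (K ℤ.* S₀)                         ≡⟨ sym (toℚ-+ S₁ (K ℤ.* S₀)) ⟩
  toℚ (S₁ ℤ.+ K ℤ.* S₀)                           ∎
  where
  open ≡-Reasoning
  M = scale S₁
  K = + suc ℤ.∣ S₁ ∣
  M-1≡K : M - 1ℚ ≡ toℚ K
  M-1≡K = begin
    M - 1ℚ                 ≡⟨ cong (_- 1ℚ) (trans (sym (toℚ≡fromℤ (+ 1 ℤ.+ K))) (toℚ-+ (+ 1) K)) ⟩
    1ℚ + toℚ K - 1ℚ        ≡⟨ cancel (toℚ K) ⟩
    toℚ K                  ∎
    where
    open +-*-Solver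
    cancel : ∀ k → 1ℚ + k - 1ℚ ≡ k
    cancel = solve 1 (λ k → con 1ℚ :+ k :- con 1ℚ := k) refl

mixes-pos : ∀ S₁ {S₀} → ℤ.+0 ℤ.< S₀ → MixesInto (0ℚ <_) S₁ S₀
mixes-pos S₁ {S₀} 0<S₀ = ℚ.1/ M , ℚP.positive⁻¹ (ℚ.1/ M) , ℚ.*≤* (ℤ.+≤+ (ℕ.s≤s ℕ.z≤n)) ,
  ℚP.*-cancelˡ-<-nonNeg M (subst₂ _<_ (sym (ℚP.*-zeroʳ M)) (sym (small-weight-mixture S₁ S₀))
                                      (toℚ-pos (numerator-pos S₁ 0<S₀)))
  where M = scale S₁

mixes-neg : ∀ S₁ {S₀} → S₀ ℤ.< ℤ.+0 → MixesInto (_< 0ℚ) S₁ S₀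
mixes-neg S₁ {S₀} S₀<0 = ℚ.1/ M , ℚP.positive⁻¹ (ℚ.1/ M) , ℚ.*≤* (ℤ.+≤+ (ℕ.s≤s ℕ.z≤n)) ,
  ℚP.*-cancelˡ-<-nonNeg M (subst₂ _<_ (sym (small-weight-mixture S₁ S₀)) (sym (ℚP.*-zeroʳ M))
                                      (toℚ-neg (numerator-neg S₁ S₀<0)))
  where M = scale S₁

mix-self : ∀ a s → a * s + (1ℚ - a) * s ≡ s
mix-self = solve 2 (λ a s → a :* s :+ (con 1ℚ :- a) :* s := s) refl
  where open +-*-Solver

mixed-with-itself : ∀ (P : ℚ → Set) S₀ → MixesInto P S₀ S₀ → P (toℚ S₀)
mixed-with-itself P _ (a , _ , _ , P-mix) = subst P (mix-self a _) P-mix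

sum-mono-≤ : ∀ {n} {f g : Fin n → ℤ} → (∀ i → f i ℤ.≤ g i) → sum f ℤ.≤ sum g
sum-mono-≤ {zero}  f≤g = ℤP.≤-refl
sum-mono-≤ {suc n} f≤g = ℤP.+-mono-≤ (f≤g zero) (sum-mono-≤ (λ i → f≤g (suc i)))

sum-neg : ∀ {n} (f : Fin n → ℤ) → sum (λ i → ℤ.- f i) ≡ ℤ.- sum f
sum-neg {zero}  f = refl
sum-neg {suc n} f = trans (cong (λ s → ℤ.- f zero ℤ.+ s) (sum-neg (λ i → f (suc i))))
                          (sym (ℤP.neg-distrib-+ (f zero) _))

sum-≤-term : ∀ {n} (g : Fin n → ℤ) (x : Fin n) →
  (∀ y → y ≢ x → g y ℤ.≤ + 0) → sum g ℤ.≤ g x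
sum-≤-term {suc n} g x others≤0 = begin
  sum g                      ≡⟨ sum-remove {i = x} g ⟩
  g x ℤ.+ sum (removeAt g x) ≤⟨ ℤP.+-monoʳ-≤ (g x) rest≤0 ⟩
  g x ℤ.+ + 0                ≡⟨ ℤP.+-identityʳ (g x) ⟩
  g x                        ∎
  where
  open ℤP.≤-Reasoning
  rest≤0 : sum (removeAt g x) ℤ.≤ + 0
  rest≤0 = ℤP.≤-trans (sum-mono-≤ (λ j → others≤0 (punchIn x j) (punchInᵢ≢i x j)))
                      (ℤP.≤-reflexive (sum-replicate-zero n))

double-<-sum-replicate : ∀ {n t} → 3 ≤ n → ℤ.+0 ℤ.< t → t ℤ.+ t ℤ.< sum (replicate n t)
double-<-sum-replicate {suc (suc (suc k))} {t} (ℕ.s≤s (ℕ.s≤s (ℕ.s≤s _))) 0<t = begin-strict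
  t ℤ.+ t                        ≡⟨ cong (λ s → t ℤ.+ s) (sym (ℤP.+-identityʳ t)) ⟩
  t ℤ.+ (t ℤ.+ + 0)              <⟨ ℤP.+-monoʳ-< t (ℤP.+-monoʳ-< t (ℤP.+-mono-<-≤ 0<t rest≥0)) ⟩
  t ℤ.+ (t ℤ.+ (t ℤ.+ sum (replicate k t))) ∎
  where
  open ℤP.≤-Reasoning
  rest≥0 : + 0 ℤ.≤ sum (replicate k t)
  rest≥0 = ℤP.≤-trans (ℤP.≤-reflexive (sym (sum-replicate-zero k)))
                      (sum-mono-≤ {f = replicate k (+ 0)} (λ _ → ℤP.<⇒≤ 0<t))

positive-entry : ∀ {n} (v : Fin n → ℤ) → sum v ≡ + 0 → ∀ x → v x ≢ + 0 →
  ∃[ y ] ℤ.+0 ℤ.< v y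
positive-entry v Σ≡0 x vx≢0 with any? (λ y → ℤ.+0 ℤ.<? v y)
... | yes found = found
... | no none = ⊥-elim (vx≢0 (ℤP.≤-antisym (nonpos x) 0≤vx))
  where
  nonpos : ∀ y → v y ℤ.≤ + 0
  nonpos y = ℤP.≮⇒≥ (λ 0<vy → none (y , 0<vy))
  0≤vx : + 0 ℤ.≤ v x
  0≤vx = subst (ℤ._≤ v x) Σ≡0 (sum-≤-term v x (λ y _ → nonpos y))

-- In a zero-sum vector of length at least 3, a positive entry v x has a partner
-- y ≢ x with v y + v x > 0: otherwise summing v y + v x over all y gives
-- n·v x ≤ 2·v x.
positive-partner : ∀ {n} (v : Fin n → ℤ) → 3 ≤ n → sum v ≡ + 0 → ∀ x → ℤ.+0 ℤ.< v x →
  ∃[ y ] (y ≢ x × ℤ.+0 ℤ.< v y ℤ.+ v x)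
positive-partner {n} v 3≤n Σ≡0 x 0<vx
  with any? (λ y → ¬? (y ≟ᶠ x) ×-dec (ℤ.+0 ℤ.<? v y ℤ.+ v x))
... | yes found = found
... | no none = ⊥-elim (ℤP.<⇒≱ (double-<-sum-replicate 3≤n 0<vx) (begin
  sum (replicate n (v x))                 ≡⟨ sym (ℤP.+-identityˡ _) ⟩
  + 0 ℤ.+ sum (replicate n (v x))         ≡⟨ cong (ℤ._+ sum (replicate n (v x))) (sym Σ≡0) ⟩
  sum v ℤ.+ sum (replicate n (v x))       ≡⟨ sym (∑-distrib-+ v (replicate n (v x))) ⟩
  sum (λ y → v y ℤ.+ v x)                 ≤⟨ sum-≤-term (λ y → v y ℤ.+ v x) x others≤0 ⟩
  v x ℤ.+ v x                             ∎))
  where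
  open ℤP.≤-Reasoning
  others≤0 : ∀ y → y ≢ x → v y ℤ.+ v x ℤ.≤ + 0
  others≤0 y y≢x = ℤP.≮⇒≥ (λ 0<sum → none (y , y≢x , 0<sum))

positive-pair : ∀ {n} (v : Fin n → ℤ) → 3 ≤ n → sum v ≡ + 0 → ∀ x → v x ≢ + 0 →
  ∃[ y ] ∃[ z ] (y ≢ z × ℤ.+0 ℤ.< v y ℤ.+ v z)
positive-pair v 3≤n Σ≡0 x vx≢0 =
  let (z , 0<vz)        = positive-entry v Σ≡0 x vx≢0
      (y , y≢z , 0<sum) = positive-partner v 3≤n Σ≡0 z 0<vz
  in  y , z , y≢z , 0<sum

negative-pair : ∀ {n} (v : Fin n → ℤ) → 3 ≤ n → sum v ≡ + 0 → ∀ x → v x ≢ + 0 →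
  ∃[ y ] ∃[ z ] (y ≢ z × v y ℤ.+ v z ℤ.< ℤ.+0)
negative-pair v 3≤n Σ≡0 x vx≢0 =
  let (y , z , y≢z , 0<sum) = positive-pair (λ i → ℤ.- v i) 3≤n
                                (trans (sum-neg v) (cong ℤ.-_ Σ≡0)) x
                                (λ -vx≡0 → vx≢0 (ℤP.neg-injective -vx≡0))
  in  y , z , y≢z , ℤP.neg-cancel-< (subst (ℤ.+0 ℤ.<_) (sym (ℤP.neg-distrib-+ (v y) (v z))) 0<sum)

weight : ∀ {n} → Maybe (Fin n) → Fin n → ℤ
weight nothing  x = + 0
weight (just z) x with z ≟ᶠ x
... | yes _ = + 1
... | no  _ = -[1+ 0 ]

W≡weight : ∀ {n} (c : PartialChoice n) x y → W c x y ≡ weight (ch c x y) x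
W≡weight c x y with ch c x y
... | nothing = refl
... | just z with z ≟ᶠ x
...   | yes _ = refl
...   | no  _ = refl

weight-chosen : ∀ {n} (x : Fin n) → weight (just x) x ≡ + 1
weight-chosen x with x ≟ᶠ x
... | yes _   = refl
... | no  x≢x = ⊥-elim (x≢x refl)

weight-unchosen : ∀ {n} {z x : Fin n} → z ≢ x → weight (just z) x ≡ -[1+ 0 ]
weight-unchosen {z = z} {x} z≢x with z ≟ᶠ x
... | yes z≡x = ⊥-elim (z≢x z≡x)
... | no  _   = refl

weight-antisym : ∀ {n} {x y : Fin n} (m : Maybe (Fin n)) → x ≢ y →
  (∀ z → m ≡ just z → z ≡ x ⊎ z ≡ y) → weight m x ≡ ℤ.- weight m y
weight-antisym nothing  x≢y _ = refl
weight-antisym (just z) x≢y chosen with chosen z refl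
... | inj₁ refl = trans (weight-chosen z) (cong ℤ.-_ (sym (weight-unchosen x≢y)))
... | inj₂ refl = trans (weight-unchosen (λ z≡x → x≢y (sym z≡x))) (cong ℤ.-_ (sym (weight-chosen z)))

W-diag : ∀ {n} (c : PartialChoice n) x → W c x x ≡ + 0
W-diag c x = trans (W≡weight c x x) (cong (λ m → weight m x) (diag c x))

W-antisym : ∀ {n} (c : PartialChoice n) x y → W c x y ≡ ℤ.- W c y x
W-antisym c x y with x ≟ᶠ y
... | yes refl = trans (W-diag c x) (cong ℤ.-_ (sym (W-diag c x)))
... | no  x≢y  = begin
  W c x y                          ≡⟨ W≡weight c x y ⟩
  weight (ch c x y) x              ≡⟨ weight-antisym (ch c x y) x≢y (chooses c x y) ⟩
  ℤ.- weight (ch c x y) y          ≡⟨ cong (λ m → ℤ.- weight m y) (symm c x y) ⟩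
  ℤ.- weight (ch c y x) y          ≡⟨ cong ℤ.-_ (sym (W≡weight c y x)) ⟩
  ℤ.- W c y x                      ∎
  where open ≡-Reasoning

W-cases : ∀ {n} (c : PartialChoice n) x y →
  W c x y ≡ + 0 ⊎ W c x y ≡ + 1 ⊎ W c x y ≡ -[1+ 0 ]
W-cases c x y with ch c x y
... | nothing = inj₁ refl
... | just z with z ≟ᶠ x
...   | yes _ = inj₂ (inj₁ refl)
...   | no  _ = inj₂ (inj₂ refl)

sumℤ-tabulate : ∀ {n} (f : Fin n → ℤ) → sumℤ (tabulate f) ≡ sum f
sumℤ-tabulate {zero}  f = refl
sumℤ-tabulate {suc n} f = cong (λ s → f zero ℤ.+ s) (sumℤ-tabulate (λ i → f (suc i)))

val≡sum : ∀ {n} (c : PartialChoice n) x → val c x ≡ sum (W c x)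
val≡sum c x = trans (cong sumℤ (map-tabulate (λ i → i) (W c x))) (sumℤ-tabulate (W c x))

-- Valences sum to zero, by antisymmetry of W.
valences-sum-zero : ∀ {n} (c : PartialChoice n) → sum (val c) ≡ + 0
valences-sum-zero {n} c = self-neg (begin
  sum (val c)                                ≡⟨ sum-cong-≗ (val≡sum c) ⟩
  sum (λ x → sum (λ y → W c x y))            ≡⟨ ∑-comm (W c) ⟩
  sum (λ y → sum (λ x → W c x y))            ≡⟨ sum-cong-≗ (λ y → sum-cong-≗ (λ x → W-antisym c x y)) ⟩
  sum (λ y → sum (λ x → ℤ.- W c y x))        ≡⟨ sum-cong-≗ (λ y → sum-neg (W c y)) ⟩
  sum (λ y → ℤ.- sum (W c y))                ≡⟨ sum-neg (λ y → sum (W c y)) ⟩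
  ℤ.- sum (λ y → sum (W c y))                ≡⟨ cong ℤ.-_ (sym (sum-cong-≗ (val≡sum c))) ⟩
  ℤ.- sum (val c)                            ∎)
  where
  open ≡-Reasoning
  self-neg : ∀ {t} → t ≡ ℤ.- t → t ≡ + 0
  self-neg {+ zero}   _  = refl
  self-neg {+[1+ _ ]} ()
  self-neg { -[1+ _ ]} ()

decided-pair : ∀ {n} (c : PartialChoice n) x → val c x ≢ + 0 →
  ∃[ u ] ∃[ w ] (u ≢ w × W c u w ≡ + 1)
decided-pair {n} c x val≢0 with any? (λ y → ¬? (W c x y ℤ.≟ + 0))
... | no none = ⊥-elim (val≢0 (begin
  val c x              ≡⟨ val≡sum c x ⟩
  sum (W c x)          ≡⟨ sum-cong-≗ all-zero ⟩
  sum (replicate n (+ 0)) ≡⟨ sum-replicate-zero n ⟩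
  + 0                  ∎))
  where
  open ≡-Reasoning
  all-zero : ∀ y → W c x y ≡ + 0
  all-zero y = decidable-stable (W c x y ℤ.≟ + 0) (λ W≢0 → none (y , W≢0))
... | yes (y , W≢0) with W-cases c x y
...   | inj₁ W≡0        = ⊥-elim (W≢0 W≡0)
...   | inj₂ (inj₁ W≡1) = x , y , x≢y , W≡1
  where x≢y : x ≢ y
        x≢y refl = W≢0 (W-diag c x)
...   | inj₂ (inj₂ W≡-1) = y , x , y≢x , trans (W-antisym c y x) (cong ℤ.-_ W≡-1)
  where y≢x : y ≢ x
        y≢x refl = W≢0 (W-diag c y)

coordSum : Point → ℚ
coordSum (p , q) = p + q

coordSum-mix : ∀ a b P Q → coordSum ((a · P) ⊕ (b · Q)) ≡ a * coordSum P + b * coordSum Q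
coordSum-mix a b (p , q) (p′ , q′) = linear a b p q p′ q′
  where
  open +-*-Solver
  linear : ∀ a b p q p′ q′ → (a * p + b * p′) + (a * q + b * q′) ≡ a * (p + q) + b * (p′ + q′)
  linear = solve 6 (λ a b p q p′ q′ → (a :* p :+ b :* p′) :+ (a :* q :+ b :* q′)
                                   := a :* (p :+ q) :+ b :* (p′ :+ q′)) refl

conv-point : ∀ {A : Point → Set} {P} → A P → Conv A P
conv-point {P = p , q} AP =
  ((1ℚ , (p , q)) ∷ []) , ((ℚP.nonNegative⁻¹ 1ℚ , AP) ∷ []) , ℚP.+-identityʳ 1ℚ ,
  cong₂ _,_ (unit p) (unit q)
  where
  unit : ∀ r → 1ℚ * r + 0ℚ ≡ r
  unit r = trans (ℚP.+-identityʳ (1ℚ * r)) (ℚP.*-identityˡ r)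

Vpoint : ∀ {n} → PartialChoice n → ℤ → Fin n → Fin n → Point
Vpoint c ℓ x y = (toℚ (val c x ℤ.- ℓ) , toℚ (val c y ℤ.+ ℓ))

coordSum-Vpoint : ∀ {n} (c : PartialChoice n) ℓ x y → coordSum (Vpoint c ℓ x y) ≡ toℚ (val c x ℤ.+ val c y)
coordSum-Vpoint c ℓ x y = trans (sym (toℚ-+ (val c x ℤ.- ℓ) (val c y ℤ.+ ℓ)))
                                (cong toℚ (shift (val c x) (val c y) ℓ))
  where
  shift : ∀ a b l → (a ℤ.- l) ℤ.+ (b ℤ.+ l) ≡ a ℤ.+ b
  shift = solve-∀

Vstar-decided : ∀ {n} (c : PartialChoice n) {x y} → x ≢ y → W c x y ≡ + 1 → Vstar c (Vpoint c (+ 1) x y)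
Vstar-decided c {x} {y} x≢y W≡1 = 1ℚ , ℚP.positive⁻¹ 1ℚ , ℚP.≤-refl , Vpoint c (+ 1) x y ,
  conv-point (x , y , x≢y , W≡1 , refl) , inj₁ (refl , refl)

Vstar-mixed : ∀ {n} (c : PartialChoice n) {u w x y} → u ≢ w → W c u w ≡ + 1 → x ≢ y → W c x y ≡ + 0 →
  ∀ {a} → 0ℚ < a → a ℚ.≤ 1ℚ → Vstar c ((a · Vpoint c (+ 1) u w) ⊕ ((1ℚ - a) · Vpoint c (+ 0) x y))
Vstar-mixed c {u} {w} {x} {y} u≢w W≡1 x≢y W≡0 {a} 0<a a≤1 = a , 0<a , a≤1 , Vpoint c (+ 1) u w ,
  conv-point (u , w , u≢w , W≡1 , refl) ,
  inj₂ (Vpoint c (+ 0) x y , conv-point (x , y , x≢y , W≡0 , refl) , refl)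

Reaches : ∀ {n} → PartialChoice n → (ℚ → Set) → Set
Reaches c P = ∃[ p ] ∃[ q ] (Vstar c (p , q) × P (p + q))

reach : ∀ {n} (c : PartialChoice n) (P : ℚ → Set) pt → Vstar c pt → P (coordSum pt) → Reaches c P
reach c P (p , q) in-V* P-sum = p , q , in-V* , P-sum

reach-decided : ∀ {n} (c : PartialChoice n) (P : ℚ → Set) {x y} → x ≢ y → W c x y ≡ + 1 →
  P (toℚ (val c x ℤ.+ val c y)) → Reaches c P
reach-decided c P {x} {y} x≢y W≡1 P-sum =
  reach c P (Vpoint c (+ 1) x y) (Vstar-decided c x≢y W≡1)
    (subst P (sym (coordSum-Vpoint c (+ 1) x y)) P-sum)

reach-mixed : ∀ {n} (c : PartialChoice n) (P : ℚ → Set) {u w x y} →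
  u ≢ w → W c u w ≡ + 1 → x ≢ y → W c x y ≡ + 0 →
  MixesInto P (val c u ℤ.+ val c w) (val c x ℤ.+ val c y) → Reaches c P
reach-mixed c P {u} {w} {x} {y} u≢w Wuw≡1 x≢y W≡0 (a , 0<a , a≤1 , P-mix) =
  reach c P ((a · P₁) ⊕ ((1ℚ - a) · P₀)) (Vstar-mixed c u≢w Wuw≡1 x≢y W≡0 0<a a≤1)
    (subst P (sym sum≡mixture) P-mix)
  where
  open ≡-Reasoning
  P₁ = Vpoint c (+ 1) u w
  P₀ = Vpoint c (+ 0) x y
  sum≡mixture : coordSum ((a · P₁) ⊕ ((1ℚ - a) · P₀))
              ≡ a * toℚ (val c u ℤ.+ val c w) + (1ℚ - a) * toℚ (val c x ℤ.+ val c y)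
  sum≡mixture = begin
    coordSum ((a · P₁) ⊕ ((1ℚ - a) · P₀))           ≡⟨ coordSum-mix a (1ℚ - a) P₁ P₀ ⟩
    a * coordSum P₁ + (1ℚ - a) * coordSum P₀        ≡⟨ cong₂ (λ s₁ s₀ → a * s₁ + (1ℚ - a) * s₀)
                                                         (coordSum-Vpoint c (+ 1) u w)
                                                         (coordSum-Vpoint c (+ 0) x y) ⟩
    a * toℚ (val c u ℤ.+ val c w) + (1ℚ - a) * toℚ (val c x ℤ.+ val c y) ∎

-- Key step: if V₁(c) is nonempty and every mixture with S₀ = val x + val y of a
-- pair x ≢ y can be made to satisfy P, then V*(c) reaches P. A decided pair uses
-- the trivial mixture of S₀ with itself, an undecided one a genuine mixture.
reach-pair : ∀ {n} (c : PartialChoice n) (P : ℚ → Set) {u w x y} →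
  u ≢ w → W c u w ≡ + 1 → x ≢ y → (∀ S₁ → MixesInto P S₁ (val c x ℤ.+ val c y)) → Reaches c P
reach-pair c P {u} {w} {x} {y} u≢w Wuw≡1 x≢y mixes = by-cases (W-cases c x y)
  where
  S₀ = val c x ℤ.+ val c y
  by-cases : W c x y ≡ + 0 ⊎ W c x y ≡ + 1 ⊎ W c x y ≡ -[1+ 0 ] → Reaches c P
  by-cases (inj₁ W≡0)         = reach-mixed c P u≢w Wuw≡1 x≢y W≡0 (mixes (val c u ℤ.+ val c w))
  by-cases (inj₂ (inj₁ W≡1))  = reach-decided c P x≢y W≡1 (mixed-with-itself P S₀ (mixes S₀))
  by-cases (inj₂ (inj₂ W≡-1)) = reach-decided c P (λ y≡x → x≢y (sym y≡x))
    (trans (W-antisym c y x) (cong ℤ.-_ W≡-1))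
    (subst (λ s → P (toℚ s)) (ℤP.+-comm (val c x) (val c y)) (mixed-with-itself P S₀ (mixes S₀)))

mainTheorem9 : (n : ℕ) → 3 ≤ n → (c : PartialChoice n) → Imbalanced c →
    (∃[ p ] ∃[ q ] (Vstar c (p , q) × 0ℚ < p + q))
    × (∃[ p' ] ∃[ q' ] (Vstar c (p' , q') × p' + q' < 0ℚ))
mainTheorem9 n 3≤n c (x , val≢0) =
  let (u , w , u≢w , W≡1)       = decided-pair c x val≢0
      (y , z , y≢z , 0<val+val) = positive-pair (val c) 3≤n (valences-sum-zero c) x val≢0
      (y′ , z′ , y′≢z′ , val+val<0) = negative-pair (val c) 3≤n (valences-sum-zero c) x val≢0
  in  reach-pair c (0ℚ <_) u≢w W≡1 y≢z (λ S₁ → mixes-pos S₁ 0<val+val) ,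
      reach-pair c (_< 0ℚ) u≢w W≡1 y′≢z′ (λ S₁ → mixes-neg S₁ val+val<0)
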